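{- Let $\mathcal{F} \subset \mathcal{P}([n])$ be an $r$-closed $\theta$-intersecting family, where $r \geq 3$ and $\theta \in (0,1)$. Then for all $A, B \in \mathcal{F}_{\mathrm{nor}}^{*}$, $\mathrm{petal}(A) \cap \mathrm{core}(B) = \emptyset$.
   Context: A family $\mathcal{F} \subset \mathcal{P}([n])$ is $r$-closed $\theta$-intersecting if for each $2 \leq t \leq r$ and any $t$ distinct sets $A_1,\dots,A_t \in \mathcal{F}$ we have $|A_1 \cap \dots \cap A_t| \in \{\theta|A_1|, \dots, \theta|A_t|\}$. $\mathcal{F}(i) := \mathcal{F} \cap \binom{[n]}{i}$. For $A \in \mathcal{F}$, $\mathrm{Tor}(A) := \{B \in \mathcal{F} : |B| \geq |A|,\ |A \cap B| = \theta|A|\}$. When $\mathrm{Tor}(A) \neq \emptyset$, $\mathrm{core}(A) := A \cap B$ for any $B \in \mathrm{Tor}(A)$ (independent of the choice of $B$), and $\mathrm{petal}(A) := A \setminus \mathrm{core}(A)$. $S := \{i \in [n] : \mathcal{F}(i) \neq \emptyset\}$, $S_{\mathrm{nor}} := \{i \in S : \mathrm{Tor}(A) \neq \emptyset \text{ for all } A \in \mathcal{F}(i)\}$, $i_{\max} := \max S_{\mathrm{nor}}$, and $\mathcal{F}_{\mathrm{nor}} := \bigcup_{i \in S_{\mathrm{nor}}} \mathcal{F}(i)$. There is at most one set $A \in \mathcal{F}_{\mathrm{nor}}$ for which there exists $B \in \mathcal{F}(i_{\max})$ with $\mathrm{petal}(A) \cap \mathrm{core}(B) \neq \emptyset$;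 when it exists it is denoted $E_{\mathrm{nor}}$. Define $\mathcal{F}_{\mathrm{nor}}^{*} := \mathcal{F}_{\mathrm{nor}} \setminus \{E_{\mathrm{nor}}\}$ (so $\mathcal{F}_{\mathrm{nor}}^{*} = \mathcal{F}_{\mathrm{nor}}$ if $E_{\mathrm{nor}}$ does not exist).
   Formalization: The parameter θ is a rational number in (0,1). -}

module Defs where

open import Data.Nat using (ℕ; _≤_; _≥_)
open import Data.Integer using (+_)
open import Data.Fin using (Fin)
open import Data.Fin.Subset using (Subset; _∩_; _─_; ∣_∣; Empty; Nonempty; ⊤)
open import Data.Rational using (ℚ; _/_; _*_)
open import Data.Product using (Σ; ∃; _×_)
open import Data.Vec using (foldr′)
open import Data.Vec.Functional using (Vector; toVec)
open import Function.Definitions using (Injective)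
open import Relation.Binary.PropositionalEquality using (_≡_)
open import Relation.Nullary using (¬_)

Family : ℕ → Set₁
Family n = Subset n → Set

ℕ→ℚ : ℕ → ℚ
ℕ→ℚ k = (+ k) / 1

⋂ᵥ : ∀ {n t} → Vector (Subset n) t → Subset n
⋂ᵥ {t = t} As = foldr′ _∩_ ⊤ (toVec As)

ClosedIntersecting : ∀ {n} → ℕ → ℚ → Family n → Set
ClosedIntersecting {n} r θ F =
  (t : ℕ) → 2 ≤ t → t ≤ r →
  (As : Vector (Subset n) t) → Injective _≡_ _≡_ As → (∀ i → F (As i)) →
  Σ (Fin t) λ i → ℕ→ℚ ∣ ⋂ᵥ As ∣ ≡ θ * ℕ→ℚ ∣ As i ∣

module _ {n : ℕ} (θ : ℚ) (F : Family n) where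

  InTor : Subset n → Subset n → Set
  InTor A B = F B × ∣ B ∣ ≥ ∣ A ∣ × ℕ→ℚ ∣ A ∩ B ∣ ≡ θ * ℕ→ℚ ∣ A ∣

  -- C is core(A), i.e. C = A ∩ B for some B ∈ Tor(A)
  -- (the paper shows this does not depend on the choice of B)
  IsCore : Subset n → Subset n → Set
  IsCore A C = Σ (Subset n) λ B → InTor A B × C ≡ A ∩ B

  IsPetal : Subset n → Subset n → Set
  IsPetal A P = Σ (Subset n) λ C → IsCore A C × P ≡ A ─ C

  InS : ℕ → Set
  InS i = Σ (Subset n) λ A → F A × ∣ A ∣ ≡ i

  InSnor : ℕ → Set
  InSnor i = InS i × (∀ A → F A → ∣ A ∣ ≡ i → Σ (Subset n) λ B → InTor A B)

  IsImax : ℕ → Set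
  IsImax i = InSnor i × (∀ j → InSnor j → j ≤ i)

  InFnor : Subset n → Set
  InFnor A = F A × InSnor ∣ A ∣

  -- A = E_nor : A ∈ F_nor and petal(A) ∩ core(B) ≠ ∅ for some B ∈ F(i_max)
  -- (the paper shows there is at most one such A)
  IsEnor : Subset n → Set
  IsEnor A = InFnor A × Σ (Subset n) λ B → F B × Σ ℕ λ i → IsImax i × ∣ B ∣ ≡ i ×
    Σ (Subset n) λ P → Σ (Subset n) λ C → IsPetal A P × IsCore B C × Nonempty (P ∩ C)

  InFnor* : Subset n → Set
  InFnor* A = InFnor A × ¬ IsEnor A

{-# OPTIONS --safe #-}
module Submission where

open import Defs
open import Data.Nat using (ℕ; _≥_)
open import Data.Fin.Subset using (Subset; _∩_; Empty)
open import Data.Rational using (ℚ; 0ℚ; 1ℚ; _<_)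

open import Data.Bool using () renaming (_≟_ to _≟ᵇ_)
open import Data.Empty using (⊥; ⊥-elim)
open import Data.Fin using (Fin)
open import Data.Fin.Patterns using (0F; 1F; 2F)
open import Data.Fin.Subset using (_∈_; _⊆_; ∣_∣; ⊤) renaming (⊥ to ∅)
open import Data.Fin.Subset.Properties
  using (_∈?_; x∈p∩q⁺; x∈p∩q⁻; p⊂q⇒∣p∣<∣q∣; ⊥⊆; ∉⊥; ∣p∣≤n; ∩-idem; ∩-identityʳ; ∩-assoc; p∩q⊆p)
open import Data.Integer using (+_; +≤+) renaming (_≤_ to _≤ℤ_)
open import Data.Integer.Properties using (*-identityʳ; drop‿+≤+)
open import Data.Nat using (zero; suc; _≤_; z≤n; s≤s) renaming (_<_ to _<ℕ_)
open import Data.Nat.Coprimality using (1-coprimeTo) renaming (sym to coprime-sym)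
open import Data.Nat.Properties using (≤-refl; <⇒≤; <-≤-trans; ≤∧≢⇒<; m<1+n⇒m≤n; n≤0⇒n≡0; m≤n⇒m<n∨m≡n; <⇒≱)
open import Data.Product using (Σ; _×_; _,_; proj₁; proj₂)
open import Data.Rational using (mkℚ; *≤*; positive) renaming (_≤_ to _≤ℚ_; _*_ to _*ℚ_)
open import Data.Rational.Properties
  using (↥p/↧p≡p; *-monoˡ-≤-nonNeg; *-monoˡ-<-pos; pos⇒nonNeg; *-identityˡ; <⇒≢)
open import Data.Sum using (inj₁; inj₂)
open import Data.Vec.Properties using (≡-dec)
open import Relation.Binary.PropositionalEquality using (_≡_; _≢_; refl; sym; trans; cong; subst; subst₂)
open import Relation.Binary.Definitions using (DecidableEquality)
open import Relation.Nullary using (¬_; yes; no)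
open import Relation.Nullary.Decidable using (¬¬-excluded-middle)

-- If x ∈ petal(A) ∩ core(B) with core(B) = B ∩ E, E ∈ Tor(B), then for every larger member X the
-- triple B, E, X is θ-intersecting, so |B ∩ E ∩ X| ≥ θ|B| = |B ∩ E| and hence core(B) ⊆ X.
-- Taking for X a member G of size i_max and any H ∈ Tor(G) puts x into core(G), making A = E_nor.
-- Since F is an arbitrary predicate, i_max exists only up to double negation, which suffices
-- because the conclusion is a negation.

ℕ→ℚ≡mkℚ : ∀ k → ℕ→ℚ k ≡ mkℚ (+ k) 0 (coprime-sym (1-coprimeTo k))
ℕ→ℚ≡mkℚ k = ↥p/↧p≡p (mkℚ (+ k) 0 (coprime-sym (1-coprimeTo k)))

ℕ→ℚ-mono-≤ : ∀ {a b} → a ≤ b → ℕ→ℚ a ≤ℚ ℕ→ℚ b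
ℕ→ℚ-mono-≤ {a} {b} a≤b rewrite ℕ→ℚ≡mkℚ a | ℕ→ℚ≡mkℚ b =
  *≤* (subst₂ _≤ℤ_ (sym (*-identityʳ (+ a))) (sym (*-identityʳ (+ b))) (+≤+ a≤b))

ℕ→ℚ-cancel-≤ : ∀ {a b} → ℕ→ℚ a ≤ℚ ℕ→ℚ b → a ≤ b
ℕ→ℚ-cancel-≤ {a} {b} le rewrite ℕ→ℚ≡mkℚ a | ℕ→ℚ≡mkℚ b with le
... | *≤* a≤b rewrite *-identityʳ (+ a) | *-identityʳ (+ b) = drop‿+≤+ a≤b

θ*ℕ→ℚ≡ℕ→ℚ⇒≡0 : ∀ {θ} → θ < 1ℚ → ∀ k → θ *ℚ ℕ→ℚ k ≡ ℕ→ℚ k → k ≡ 0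
θ*ℕ→ℚ≡ℕ→ℚ⇒≡0 θ<1 zero      _  = refl
θ*ℕ→ℚ≡ℕ→ℚ⇒≡0 {θ} θ<1 (suc k) eq rewrite ℕ→ℚ≡mkℚ (suc k) = ⊥-elim (<⇒≢ θq<q eq)
  where
  q = mkℚ (+ suc k) 0 (coprime-sym (1-coprimeTo (suc k)))
  θq<q : θ *ℚ q < q
  θq<q = subst (θ *ℚ q <_) (*-identityˡ q) (*-monoˡ-<-pos q θ<1)

x∈p⇒∣p∣≢0 : ∀ {n} {x : Fin n} {p : Subset n} → x ∈ p → ∣ p ∣ ≢ 0
x∈p⇒∣p∣≢0 {n} {x} x∈p ∣p∣≡0 =
  <⇒≱ (p⊂q⇒∣p∣<∣q∣ (⊥⊆ , x , x∈p , ∉⊥)) (subst (_≤ ∣ ∅ {n} ∣) (sym ∣p∣≡0) z≤n)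

_≟ₛ_ : ∀ {n} → DecidableEquality (Subset n)
_≟ₛ_ = ≡-dec _≟ᵇ_

Maximum : (ℕ → Set) → Set
Maximum P = Σ ℕ λ i → P i × (∀ j → P j → j ≤ i)

¬¬-maximum : (P : ℕ → Set) (m : ℕ) → (∀ j → P j → j ≤ m) → ∀ {k} → P k → ¬ ¬ Maximum P
¬¬-maximum P m bounded {k} Pk noMaximum = ¬¬-excluded-middle λ where
    (yes Pm) → noMaximum (m , Pm , bounded)
    (no ¬Pm) → boundNotAttained m bounded ¬Pm
  where
  boundNotAttained : ∀ m → (∀ j → P j → j ≤ m) → ¬ P m → ⊥
  boundNotAttained zero    bounded ¬P0 = ¬P0 (subst P (n≤0⇒n≡0 (bounded k Pk)) Pk)
  boundNotAttained (suc m) bounded ¬Pm = ¬¬-maximum P m bounded′ Pk noMaximum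
    where
    bounded′ : ∀ j → P j → j ≤ m
    bounded′ j Pj = m<1+n⇒m≤n (≤∧≢⇒< (bounded j Pj) λ { refl → ¬Pm Pj })

module _ {n r : ℕ} {θ : ℚ} {F : Family n}
         (r≥3 : r ≥ 3) (0<θ : 0ℚ < θ) (closed : ClosedIntersecting r θ F) where

  θ*lowerBound≤∣∩₃∣ : ∀ {A₁ A₂ A₃} → F A₁ → F A₂ → F A₃ → A₁ ≢ A₂ → A₁ ≢ A₃ → A₂ ≢ A₃ →
    ∀ {m} → m ≤ ∣ A₁ ∣ → m ≤ ∣ A₂ ∣ → m ≤ ∣ A₃ ∣ → θ *ℚ ℕ→ℚ m ≤ℚ ℕ→ℚ ∣ (A₁ ∩ A₂) ∩ A₃ ∣
  θ*lowerBound≤∣∩₃∣ {A₁} {A₂} {A₃} F₁ F₂ F₃ 1≢2 1≢3 2≢3 {m} m≤₁ m≤₂ m≤₃ =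
    let i , ∣⋂As∣≡θ∣Asᵢ∣ = closed 3 (s≤s (s≤s z≤n)) r≥3 As As-injective As∈F in begin
    θ *ℚ ℕ→ℚ m                   ≤⟨ *-monoˡ-≤-nonNeg θ {{pos⇒nonNeg θ {{positive 0<θ}}}} (ℕ→ℚ-mono-≤ (m≤As i)) ⟩
    θ *ℚ ℕ→ℚ ∣ As i ∣            ≡⟨ sym ∣⋂As∣≡θ∣Asᵢ∣ ⟩
    ℕ→ℚ ∣ A₁ ∩ (A₂ ∩ (A₃ ∩ ⊤)) ∣ ≡⟨ cong (λ p → ℕ→ℚ ∣ p ∣) ⋂As≡∩₃ ⟩
    ℕ→ℚ ∣ (A₁ ∩ A₂) ∩ A₃ ∣       ∎
    where
    open Data.Rational.Properties.≤-Reasoning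
    As : Fin 3 → Subset n
    As 0F = A₁
    As 1F = A₂
    As 2F = A₃
    As∈F : ∀ i → F (As i)
    As∈F 0F = F₁
    As∈F 1F = F₂
    As∈F 2F = F₃
    m≤As : ∀ i → m ≤ ∣ As i ∣
    m≤As 0F = m≤₁
    m≤As 1F = m≤₂
    m≤As 2F = m≤₃
    As-injective : ∀ {i j} → As i ≡ As j → i ≡ j
    As-injective {0F} {0F} _ = refl
    As-injective {0F} {1F} e = ⊥-elim (1≢2 e)
    As-injective {0F} {2F} e = ⊥-elim (1≢3 e)
    As-injective {1F} {0F} e = ⊥-elim (1≢2 (sym e))
    As-injective {1F} {1F} _ = refl
    As-injective {1F} {2F} e = ⊥-elim (2≢3 e)
    As-injective {2F} {0F} e = ⊥-elim (1≢3 (sym e))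
    As-injective {2F} {1F} e = ⊥-elim (2≢3 (sym e))
    As-injective {2F} {2F} _ = refl
    ⋂As≡∩₃ : A₁ ∩ (A₂ ∩ (A₃ ∩ ⊤)) ≡ (A₁ ∩ A₂) ∩ A₃
    ⋂As≡∩₃ = trans (cong (λ p → A₁ ∩ (A₂ ∩ p)) (∩-identityʳ A₃)) (sym (∩-assoc A₁ A₂ A₃))

  core⊆larger : θ < 1ℚ → ∀ {B C X} → F B → IsCore θ F B C → F X → ∣ B ∣ <ℕ ∣ X ∣ → C ⊆ X
  core⊆larger θ<1 {B} {X = X} FB (E , (FE , ∣B∣≤∣E∣ , ∣B∩E∣≡θ∣B∣) , refl) FX ∣B∣<∣X∣ {x} x∈B∩E
    with X ≟ₛ E | B ≟ₛ E | x ∈? X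
  ... | yes refl | _        | _       = proj₂ (x∈p∩q⁻ B E x∈B∩E)
  ... | no _     | yes refl | _       =
    -- B ∈ Tor(B) forces |B| = θ|B|, i.e. B = ∅, yet x ∈ B
    ⊥-elim (x∈p⇒∣p∣≢0 (proj₁ (x∈p∩q⁻ B B x∈B∩E))
             (θ*ℕ→ℚ≡ℕ→ℚ⇒≡0 θ<1 ∣ B ∣ (trans (sym ∣B∩E∣≡θ∣B∣) (cong (λ p → ℕ→ℚ ∣ p ∣) (∩-idem B)))))
  ... | no _     | no _     | yes x∈X = x∈X
  ... | no X≢E   | no B≢E   | no x∉X  = ⊥-elim (<⇒≱ ∣B∩E∩X∣<∣B∩E∣ ∣B∩E∣≤∣B∩E∩X∣)
    where
    B≢X : B ≢ X
    B≢X refl = <⇒≱ ∣B∣<∣X∣ ≤-refl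
    ∣B∩E∣≤∣B∩E∩X∣ : ∣ B ∩ E ∣ ≤ ∣ (B ∩ E) ∩ X ∣
    ∣B∩E∣≤∣B∩E∩X∣ = ℕ→ℚ-cancel-≤ (subst (_≤ℚ ℕ→ℚ ∣ (B ∩ E) ∩ X ∣) (sym ∣B∩E∣≡θ∣B∣)
      (θ*lowerBound≤∣∩₃∣ FB FE FX B≢E B≢X (λ E≡X → X≢E (sym E≡X)) ≤-refl ∣B∣≤∣E∣ (<⇒≤ ∣B∣<∣X∣)))
    ∣B∩E∩X∣<∣B∩E∣ : ∣ (B ∩ E) ∩ X ∣ <ℕ ∣ B ∩ E ∣
    ∣B∩E∩X∣<∣B∩E∣ = p⊂q⇒∣p∣<∣q∣ (p∩q⊆p (B ∩ E) X , x , x∈B∩E , λ x∈B∩E∩X → x∉X (proj₂ (x∈p∩q⁻ (B ∩ E) X x∈B∩E∩X)))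

  core⊆coreAtImax : θ < 1ℚ → ∀ {B C i} → InFnor θ F B → IsCore θ F B C → IsImax θ F i →
    Σ (Subset n) λ B′ → F B′ × ∣ B′ ∣ ≡ i × Σ (Subset n) λ C′ → IsCore θ F B′ C′ × C ⊆ C′
  core⊆coreAtImax θ<1 {B} {C} (FB , B∈Snor) coreC (((G , FG , ∣G∣≡i) , hasTor) , maximal)
    with m≤n⇒m<n∨m≡n (maximal ∣ B ∣ B∈Snor)
  ... | inj₂ ∣B∣≡i = B , FB , ∣B∣≡i , C , coreC , λ x∈C → x∈C
  ... | inj₁ ∣B∣<i =
    let H , torH@(FH , ∣G∣≤∣H∣ , _) = hasTor G FG ∣G∣≡i
        ∣B∣<∣G∣ = subst (∣ B ∣ <ℕ_) (sym ∣G∣≡i) ∣B∣<i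
    in G , FG , ∣G∣≡i , G ∩ H , (H , torH , refl) ,
       λ x∈C → x∈p∩q⁺ ( core⊆larger θ<1 FB coreC FG ∣B∣<∣G∣ x∈C
                      , core⊆larger θ<1 FB coreC FH (<-≤-trans ∣B∣<∣G∣ ∣G∣≤∣H∣) x∈C)

corollary2p15 : (n r : ℕ) (θ : ℚ) (F : Family n) →
    r ≥ 3 → 0ℚ < θ → θ < 1ℚ → ClosedIntersecting r θ F →
    ∀ A B → InFnor* θ F A → InFnor* θ F B →
    ∀ P C → IsPetal θ F A P → IsCore θ F B C → Empty (P ∩ C)
corollary2p15 n r θ F r≥3 0<θ θ<1 closed A B (A∈Fnor , A≢Enor) (B∈Fnor , _) P C petalP coreC (x , x∈P∩C) =
  ¬¬-maximum (InSnor θ F) n sizeBound (proj₂ B∈Fnor) λ (i , imax) →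
    let B′ , FB′ , ∣B′∣≡i , C′ , coreC′ , C⊆C′ = core⊆coreAtImax r≥3 0<θ closed θ<1 B∈Fnor coreC imax
        x∈P∩C′ = x∈p∩q⁺ (proj₁ (x∈p∩q⁻ P C x∈P∩C) , C⊆C′ (proj₂ (x∈p∩q⁻ P C x∈P∩C)))
    in A≢Enor (A∈Fnor , B′ , FB′ , i , imax , ∣B′∣≡i , P , C′ , petalP , coreC′ , x , x∈P∩C′)
  where
  sizeBound : ∀ j → InSnor θ F j → j ≤ n
  sizeBound j ((S , _ , ∣S∣≡j) , _) = subst (_≤ n) ∣S∣≡j (∣p∣≤n S)
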